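{- For an integer $k\ge 0$ let $T_k=\frac{k(k+1)}{2}$. Let $n>3$ be a natural number, let $k,l$ be distinct integers with $0\le k,l\le\frac{n-1}{2}$, and suppose $2(T_l-T_k)=mn$ for some integer $m$. Then $\gcd(l-k,n)>1$ and $\gcd(l+k+1,n)>1$. -}

module Defs where

open import Data.Nat using (ℕ; suc; _*_; _/_)

-- Triangular number T_k = k(k+1)/2 (exact division in ℕ)
T : ℕ → ℕ
T k = (k * suc k) / 2

module Submission where

-- Doubling the triangular numbers clears the denominator:
-- 2(T_l − T_k) = l(l+1) − k(k+1) = (l − k)(l + k + 1).  So the hypothesis
-- says that n divides d·s with d = |l − k| and s = l + k + 1.  The bounds
-- 2k+1 ≤ n, 2l+1 ≤ n and k ≠ l give 0 < d < s < n.  Finally, whenever n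
-- divides a·b with 0 < b < n, the numbers a and n cannot be coprime (else
-- n would divide b), so gcd(a, n) > 1; applying this to d·s and to s·d
-- yields both claims.

open import Defs
open import Data.Nat using (ℕ; _<_; _≤_; _*_; _+_; suc)
open import Data.Nat.GCD using (gcd; gcd-comm; gcd[m,n]≡0⇒n≡0)
open import Data.Integer using (ℤ; +_; ∣_∣) renaming (_-_ to _-ℤ_; _*_ to _*ℤ_; _+_ to _+ℤ_)
open import Data.Product using (_×_; _,_)
open import Relation.Binary.PropositionalEquality using (_≡_; _≢_)

open import Data.Nat using (zero; s≤s; z≤n; >-nonZero)
open import Data.Nat.Properties
  using (*-comm; +-comm; +-assoc; +-identityʳ; +-monoʳ-≤; ≤-trans; ≤-reflexive;
         ≤-<-trans; <-≤-trans; <-trans; m<m+n; m<n⇒n≢0; <-cmp; module ≤-Reasoning)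
open import Data.Nat.Divisibility using (_∣_; divides; ∣m∣n⇒∣m+n; n∣m*n; >⇒∤)
open import Data.Nat.DivMod using (m*[n/m]≡n)
open import Data.Nat.Coprimality using (gcd≡1⇒coprime; coprime-divisor)
open import Data.Nat.Solver using (module +-*-Solver)
open import Data.Integer.Properties using (pos-+; pos-*; abs-*; ∣i-j∣≤∣i∣+∣j∣; ∣i∣≡0⇒i≡0; i-j≡0⇒i≡j; +-injective)
open import Data.Integer.Solver renaming (module +-*-Solver to ℤ-Solver)
open import Relation.Binary.PropositionalEquality using (refl; sym; trans; cong; cong₂; subst; module ≡-Reasoning)
open import Relation.Nullary using (contradiction)
open import Relation.Binary using (tri<; tri≈; tri>)

-- The product of two consecutive numbers is even; this makes the division
-- in the definition of T exact.
consecutive-product-even : ∀ k → 2 ∣ k * suc k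
consecutive-product-even zero    = divides 0 refl
consecutive-product-even (suc k) =
  subst (2 ∣_) (step k) (∣m∣n⇒∣m+n (consecutive-product-even k) (n∣m*n (suc k)))
  where
  open +-*-Solver
  step : ∀ k → k * suc k + suc k * 2 ≡ suc k * suc (suc k)
  step = solve 1 (λ k → k :* (con 1 :+ k) :+ (con 1 :+ k) :* con 2
                      := (con 1 :+ k) :* (con 2 :+ k)) refl

double-triangular : ∀ k → 2 * T k ≡ k * suc k
double-triangular k = m*[n/m]≡n (consecutive-product-even k)

pos-consecutive-product : ∀ k → + (k * suc k) ≡ + k *ℤ (+ 1 +ℤ + k)
pos-consecutive-product k = trans (pos-* k (suc k)) (cong (+ k *ℤ_) (pos-+ 1 k))

double-triangular-difference : ∀ k l →
  + 2 *ℤ (+ T l -ℤ + T k) ≡ (+ l -ℤ + k) *ℤ + (l + k + 1)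
double-triangular-difference k l = begin
  + 2 *ℤ (+ T l -ℤ + T k)
    ≡⟨ distrib (+ T l) (+ T k) ⟩
  + 2 *ℤ + T l -ℤ + 2 *ℤ + T k
    ≡⟨ cong₂ _-ℤ_ (sym (pos-* 2 (T l))) (sym (pos-* 2 (T k))) ⟩
  + (2 * T l) -ℤ + (2 * T k)
    ≡⟨ cong₂ (λ a b → + a -ℤ + b) (double-triangular l) (double-triangular k) ⟩
  + (l * suc l) -ℤ + (k * suc k)
    ≡⟨ cong₂ _-ℤ_ (pos-consecutive-product l) (pos-consecutive-product k) ⟩
  + l *ℤ (+ 1 +ℤ + l) -ℤ + k *ℤ (+ 1 +ℤ + k)
    ≡⟨ factor (+ l) (+ k) ⟩
  (+ l -ℤ + k) *ℤ (+ l +ℤ + k +ℤ + 1)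
    ≡⟨ cong ((+ l -ℤ + k) *ℤ_) (sym (trans (pos-+ (l + k) 1) (cong (_+ℤ + 1) (pos-+ l k)))) ⟩
  (+ l -ℤ + k) *ℤ + (l + k + 1) ∎
  where
  open ≡-Reasoning
  open ℤ-Solver
  distrib : ∀ a b → + 2 *ℤ (a -ℤ b) ≡ + 2 *ℤ a -ℤ + 2 *ℤ b
  distrib = solve 2 (λ a b → con (+ 2) :* (a :- b) := con (+ 2) :* a :- con (+ 2) :* b) refl
  factor : ∀ a b → a *ℤ (+ 1 +ℤ a) -ℤ b *ℤ (+ 1 +ℤ b) ≡ (a -ℤ b) *ℤ (a +ℤ b +ℤ + 1)
  factor = solve 2 (λ a b → a :* (con (+ 1) :+ a) :- b :* (con (+ 1) :+ b)
                         := (a :- b) :* (a :+ b :+ con (+ 1))) refl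

-- If n divides a·b while 0 < b < n, then gcd(a, n) > 1: the gcd is not 0
-- because n ≠ 0, and not 1 because coprimality would force n ∣ b.
gcd-nontrivial : ∀ a {b n} → n ∣ a * b → 0 < b → b < n → 1 < gcd a n
gcd-nontrivial a {b} {n} n∣ab 0<b b<n with gcd a n in gcd≡
... | 0           = contradiction (gcd[m,n]≡0⇒n≡0 a gcd≡) (m<n⇒n≢0 b<n)
... | 1           = contradiction n∣b (>⇒∤ {{>-nonZero 0<b}} b<n)
  where n∣b : n ∣ b
        n∣b = coprime-divisor (gcd≡1⇒coprime (trans (gcd-comm n a) gcd≡)) n∣ab
... | suc (suc _) = s≤s (s≤s z≤n)

sum-below-double : ∀ {k l} → k < l → l + k + 1 ≤ 2 * l
sum-below-double {k} {l} k<l = begin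
  l + k + 1    ≡⟨ +-assoc l k 1 ⟩
  l + (k + 1)  ≡⟨ cong (λ x → l + x) (+-comm k 1) ⟩
  l + suc k    ≤⟨ +-monoʳ-≤ l k<l ⟩
  l + l        ≡⟨ cong (λ x → l + x) (sym (+-identityʳ l)) ⟩
  2 * l        ∎
  where open ≤-Reasoning

sum-bound-ordered : ∀ {n k l} → k < l → 2 * l + 1 ≤ n → l + k + 1 < n
sum-bound-ordered {n} {k} {l} k<l 2l+1≤n =
  <-≤-trans (s≤s (sum-below-double k<l)) (≤-trans (≤-reflexive (+-comm 1 (2 * l))) 2l+1≤n)

sum-bound : ∀ {n k l} → k ≢ l → 2 * k + 1 ≤ n → 2 * l + 1 ≤ n → l + k + 1 < n
sum-bound {n} {k} {l} k≢l 2k+1≤n 2l+1≤n with <-cmp k l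
... | tri< k<l _ _ = sum-bound-ordered k<l 2l+1≤n
... | tri≈ _ k≡l _ = contradiction k≡l k≢l
... | tri> _ _ l<k = subst (_< n) (cong (_+ 1) (+-comm k l)) (sum-bound-ordered l<k 2k+1≤n)

difference-below-sum : ∀ k l → ∣ + l -ℤ + k ∣ < l + k + 1
difference-below-sum k l = ≤-<-trans (∣i-j∣≤∣i∣+∣j∣ (+ l) (+ k)) (m<m+n (l + k) (s≤s z≤n))

difference-positive : ∀ {k l} → k ≢ l → 0 < ∣ + l -ℤ + k ∣
difference-positive {k} {l} k≢l with ∣ + l -ℤ + k ∣ in d≡
... | zero  = contradiction (sym (+-injective (i-j≡0⇒i≡j (+ l) (+ k) (∣i∣≡0⇒i≡0 d≡)))) k≢l
... | suc _ = s≤s z≤n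

divides-abs-product : ∀ {b n} (i m : ℤ) → i *ℤ + b ≡ m *ℤ + n → n ∣ ∣ i ∣ * b
divides-abs-product {b} {n} i m eq = divides ∣ m ∣ (begin
  ∣ i ∣ * b          ≡⟨ sym (abs-* i (+ b)) ⟩
  ∣ i *ℤ + b ∣       ≡⟨ cong ∣_∣ eq ⟩
  ∣ m *ℤ + n ∣       ≡⟨ abs-* m (+ n) ⟩
  ∣ m ∣ * n          ∎)
  where open ≡-Reasoning

mainTheorem10 : (n k l : ℕ) → 3 < n → k ≢ l → 2 * k + 1 ≤ n → 2 * l + 1 ≤ n →
    (m : ℤ) → + 2 *ℤ (+ T l -ℤ + T k) ≡ m *ℤ + n →
    (1 < gcd ∣ + l -ℤ + k ∣ n) × (1 < gcd (l + k + 1) n)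
mainTheorem10 n k l _ k≢l 2k+1≤n 2l+1≤n m eq =
    gcd-nontrivial d n∣ds 0<s s<n
  , gcd-nontrivial s (subst (n ∣_) (*-comm d s) n∣ds) (difference-positive k≢l) d<n
  where
  d s : ℕ
  d = ∣ + l -ℤ + k ∣
  s = l + k + 1
  n∣ds : n ∣ d * s
  n∣ds = divides-abs-product (+ l -ℤ + k) m (trans (sym (double-triangular-difference k l)) eq)
  0<s : 0 < s
  0<s = ≤-<-trans z≤n (m<m+n (l + k) (s≤s z≤n))
  s<n : s < n
  s<n = sum-bound k≢l 2k+1≤n 2l+1≤n
  d<n : d < n
  d<n = <-trans (difference-below-sum k l) s<n
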